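{- For $i\in\{1,2\}$ let $G_i=(V_i,E_i)$ be finite connected graphs with $n_i=|V_i|\ge 2$, and let $u\in V_1$, $v\in V_2$. Let $G$ be the graph obtained from the disjoint union of $G_1$ and $G_2$ by adding the edge $\{u,v\}$. Let $D_G,D_1,D_2$ be the distance matrices and $K_G,K_{G_1},K_{G_2}$ the Steinerberger curvatures of $G,G_1,G_2$, and let $k_1=\sum_{x\in V_1}K_{G_1}(x)$, $k_2=\sum_{y\in V_2}K_{G_2}(y)$. Assume: (C1) $Z:=\big(2+\frac{k_1}{n_1}\big)\big(2+\frac{k_2}{n_2}\big)\neq 4$; (C2) $D_1$ and $D_2$ are invertible; (C3) $k_u:=K_{G_1}(u)\neq 0$ and $k_v:=K_{G_2}(v)\neq 0$. Then, with $$\alpha=\frac{2(n_1+n_2)k_2}{n_1n_2(Z-4)},\qquad \beta=\frac{2(n_1+n_2)k_1}{n_1n_2(Z-4)},$$ we have $K_G(x)=\alpha K_{G_1}(x)$ for all $x\in V_1\setminus\{u\}$ and $K_G(y)=\beta K_{G_2}(y)$ for all $y\in V_2\setminus\{v\}$, and $$K_G(u)=\gamma k_u,\quad K_G(v)=\delta k_v,\qquad\text{where }\gamma=\Big(1-\frac{k_1}{2k_u}\Big)\alpha,\ \ \delta=\Big(1-\frac{k_2}{2k_v}\Big)\beta.$$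
   Context: For a graph with vertices $v_1,\dots,v_n$, $D=(d(v_i,v_j))_{i,j}$ is its distance matrix and $\mathbf 1_n$ the all-ones column vector. The Steinerberger curvature is defined via $DK=n\mathbf 1_n$: if this has a unique solution (e.g. if $D$ is invertible), the curvature of $v_i$ is $K_i$; if several, $K$ is a solution maximizing $\min_iK_i$; if none, $K=nD^\dagger\mathbf 1_n$ with $D^\dagger$ the Moore–Penrose pseudoinverse. -}

module Defs where

open import Data.Bool using (Bool; true; false; _∧_; _∨_; if_then_else_)
open import Data.Nat as ℕ using (ℕ; zero; suc)
open import Data.Fin as Fin using (Fin; zero; suc; splitAt; _↑ˡ_; _↑ʳ_)
open import Data.Fin.Properties using () renaming (_≟_ to _≟ᶠ_)
open import Data.Integer using (+_)
open import Data.Rational using (ℚ; 0ℚ; _+_; _*_; _-_; _⊓_; _≤_; 1/_; _/_)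
open import Data.Rational.Properties using (_≟_)
open import Data.Sum using (_⊎_; inj₁; inj₂)
open import Data.Product using (Σ; ∃; _×_; _,_)
open import Relation.Nullary using (¬_; yes; no; does)
open import Relation.Binary.PropositionalEquality using (_≡_; _≢_; refl)

record Graph (n : ℕ) : Set where
  field
    adj     : Fin n → Fin n → Bool
    adj-sym : ∀ x y → adj x y ≡ adj y x
    adj-irr : ∀ x → adj x x ≡ false
open Graph public

anyF : ∀ {n} → (Fin n → Bool) → Bool
anyF {zero}  p = false
anyF {suc n} p = p zero ∨ anyF (λ i → p (suc i))

reach : ∀ {n} → Graph n → ℕ → Fin n → Fin n → Bool
reach G zero    x y = does (x ≟ᶠ y)
reach G (suc k) x y = reach G k x y ∨ anyF (λ z → reach G k x z ∧ adj G z y)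

Connected : ∀ {n} → Graph n → Set
Connected G = ∀ x y → ∃ λ k → reach G k x y ≡ true

-- least k < fuel with p k = true (fuel if none)
firstTrue : ℕ → (ℕ → Bool) → ℕ
firstTrue zero     p = zero
firstTrue (suc f) p = if p zero then zero else suc (firstTrue f (λ k → p (suc k)))

-- graph distance (shortest-path length); correct for connected graphs,
-- since then every distance is < n
dist : ∀ {n} → Graph n → Fin n → Fin n → ℕ
dist {n} G x y = firstTrue n (λ k → reach G k x y)

Matrix : ℕ → ℕ → Set
Matrix m n = Fin m → Fin n → ℚ

ℕtoℚ : ℕ → ℚ
ℕtoℚ k = (+ k) / 1

sumF : ∀ {n} → (Fin n → ℚ) → ℚ
sumF {zero}  f = 0ℚ
sumF {suc n} f = f zero + sumF (λ i → f (suc i))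

_⊗_ : ∀ {l m n} → Matrix l m → Matrix m n → Matrix l n
(A ⊗ B) i k = sumF (λ j → A i j * B j k)

transpose : ∀ {m n} → Matrix m n → Matrix n m
transpose A i j = A j i

idM : ∀ {n} → Matrix n n
idM i j = if does (i ≟ᶠ j) then ℕtoℚ 1 else 0ℚ

_≐_ : ∀ {m n} → Matrix m n → Matrix m n → Set
A ≐ B = ∀ i j → A i j ≡ B i j

Invertible : ∀ {n} → Matrix n n → Set
Invertible {n} A = Σ (Matrix n n) λ B → (A ⊗ B) ≐ idM × (B ⊗ A) ≐ idM

-- Moore–Penrose pseudoinverse (real matrices: conjugate transpose = transpose),
-- characterised by the four Penrose equations
IsPseudoInverse : ∀ {m n} → Matrix m n → Matrix n m → Set
IsPseudoInverse A P =
  ((A ⊗ P) ⊗ A) ≐ A × ((P ⊗ A) ⊗ P) ≐ P ×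
  transpose (A ⊗ P) ≐ (A ⊗ P) × transpose (P ⊗ A) ≐ (P ⊗ A)

distMatrix : ∀ {n} → Graph n → Matrix n n
distMatrix G i j = ℕtoℚ (dist G i j)

minAux : ∀ {n} → ℚ → (Fin n → ℚ) → ℚ
minAux {zero}  a f = a
minAux {suc n} a f = minAux (a ⊓ f zero) (λ i → f (suc i))

minF : ∀ {n} → (Fin n → ℚ) → ℚ
minF {zero}  f = 0ℚ
minF {suc n} f = minAux (f zero) (λ i → f (suc i))

Solves : ∀ {n} → Matrix n n → (Fin n → ℚ) → Set
Solves {n} D K = ∀ i → sumF (λ j → D i j * K j) ≡ ℕtoℚ n

IsCurvatureOf : ∀ {n} → Matrix n n → (Fin n → ℚ) → Set
IsCurvatureOf {n} D K =
    (Solves D K × (∀ K' → Solves D K' → ∀ i → K' i ≡ K i))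
  ⊎
    (Solves D K × (∃ λ K' → Solves D K' × ¬ (∀ i → K' i ≡ K i))
                × (∀ K' → Solves D K' → minF K' ≤ minF K))
  ⊎
    ((∀ K' → ¬ Solves D K') ×
     (∃ λ P → IsPseudoInverse D P × (∀ i → K i ≡ ℕtoℚ n * sumF (λ j → P i j))))

SteinerbergerCurvature : ∀ {n} → Graph n → (Fin n → ℚ) → Set
SteinerbergerCurvature G K = IsCurvatureOf (distMatrix G) K

-- Total division (only used with nonzero denominators)

_÷_ : ℚ → ℚ → ℚ
p ÷ q with q ≟ 0ℚ
... | yes _ = 0ℚ
... | no q≢0 = p * 1/_ q {{Data.Rational.≢-nonZero q≢0}}
  where import Data.Rational

-- G1, G2 joined by the bridge {u,v}; vertices of G1 are i ↑ˡ n2,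
-- vertices of G2 are n1 ↑ʳ j.

bridgeAdj : ∀ {n₁ n₂} → Graph n₁ → Graph n₂ → Fin n₁ → Fin n₂ →
            Fin (n₁ ℕ.+ n₂) → Fin (n₁ ℕ.+ n₂) → Bool
bridgeAdj {n₁} G₁ G₂ u v x y with splitAt n₁ x | splitAt n₁ y
... | inj₁ i | inj₁ j = adj G₁ i j
... | inj₂ i | inj₂ j = adj G₂ i j
... | inj₁ i | inj₂ j = does (i ≟ᶠ u) ∧ does (j ≟ᶠ v)
... | inj₂ i | inj₁ j = does (j ≟ᶠ u) ∧ does (i ≟ᶠ v)


bridgeAdj-sym : ∀ {n₁ n₂} (G₁ : Graph n₁) (G₂ : Graph n₂) u v x y →
                bridgeAdj G₁ G₂ u v x y ≡ bridgeAdj G₁ G₂ u v y x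
bridgeAdj-sym {n₁} G₁ G₂ u v x y with splitAt n₁ x | splitAt n₁ y
... | inj₁ i | inj₁ j = adj-sym G₁ i j
... | inj₂ i | inj₂ j = adj-sym G₂ i j
... | inj₁ i | inj₂ j = refl
... | inj₂ i | inj₁ j = refl

bridgeAdj-irr : ∀ {n₁ n₂} (G₁ : Graph n₁) (G₂ : Graph n₂) u v x →
                bridgeAdj G₁ G₂ u v x x ≡ false
bridgeAdj-irr {n₁} G₁ G₂ u v x with splitAt n₁ x
... | inj₁ i = adj-irr G₁ i
... | inj₂ i = adj-irr G₂ i

bridge : ∀ {n₁ n₂} → Graph n₁ → Graph n₂ → Fin n₁ → Fin n₂ → Graph (n₁ ℕ.+ n₂)
bridge G₁ G₂ u v = record
  { adj = bridgeAdj G₁ G₂ u v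
  ; adj-sym = bridgeAdj-sym G₁ G₂ u v
  ; adj-irr = bridgeAdj-irr G₁ G₂ u v }

-- Across the bridge d(x, w) = d₁(x, u) + 1 + d₂(v, w), so the distance matrix D of G is
-- built from D₁ and D₂. If D K = n 1 and sᵢ is the sum of K over Vᵢ, the rows indexed by V₁
-- read D₁ (K|V₁) = c₁ 1 − s₂ D₁ e_u, so invertibility of D₁ forces K|V₁ = P₁ K₁ − s₂ e_u;
-- likewise K|V₂ = P₂ K₂ − s₁ e_v. Summing these, and reading the rows at u and v, gives
-- s₁ = s₂ = P₁ k₁ / 2 and a 2 × 2 linear system for (P₁, P₂) of determinant n₁ n₂ (Z − 4) / 2,
-- whose unique solution is (α, β). Conversely that vector does solve D K = n 1, so the
-- curvature of G (whichever case of its definition applies) is this solution. The graph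
-- distances are pinned down by exhibiting walks and bounding walk lengths from below by
-- 1-Lipschitz functions.

module Submission where

open import Defs
open import Data.Nat using (ℕ) renaming (_≤_ to _≤ℕ_)
open import Data.Fin using (Fin; _↑ˡ_; _↑ʳ_)
open import Data.Rational using (ℚ; 0ℚ; _+_; _*_; _-_)
open import Data.Product using (_×_)
open import Relation.Binary.PropositionalEquality using (_≡_; _≢_)

open import Algebra.Bundles using (CommutativeMonoid; CommutativeRing)
open import Data.Bool using (Bool; true; false; T; _∧_)
open import Data.Bool.Properties using (T-≡; T-∨; T-∧)
open import Data.Fin using (zero; suc; splitAt)
open import Data.Fin.Properties using (splitAt-↑ˡ; splitAt-↑ʳ; splitAt⁻¹-↑ˡ; splitAt⁻¹-↑ʳ)
  renaming (_≟_ to _≟ᶠ_)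
open import Data.Fin.Subset using (Subset; _∈_; _⊆_; ∣_∣)
open import Data.Fin.Subset.Properties using (_∈?_; _⊂?_; p⊂q⇒∣p∣<∣q∣; ∣p∣≤n; ∣⊥∣≡0; ∉⊥; ⊥⊆)
import Data.Integer as ℤ
import Data.Integer.Properties as ℤₚ
open import Data.List using ([]; _∷_)
import Data.Nat as ℕ
open import Data.Nat using (zero; suc; s≤s)
import Data.Nat.Coprimality as Coprime
import Data.Nat.Properties as ℕₚ
open import Data.Product using (∃; _,_; proj₁; proj₂)
open import Data.Rational using (1ℚ; ½; -_; 1/_; NonZero; ≢-nonZero; ↥_; mkℚ)
open import Data.Rational.Properties
  using (+-*-commutativeRing; *-1-commutativeMonoid; +-0-commutativeMonoid; _≟_; *-assoc; *-identityˡ; *-identityʳ; *-zeroˡ;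
         *-inverseˡ; *-inverseʳ; +-identityˡ; +-identityʳ; +-assoc; +-comm; neg-distribˡ-*; *-distribʳ-+;
         normalize-coprime)
open import Algebra.Properties.CommutativeSemigroup (CommutativeMonoid.commutativeSemigroup *-1-commutativeMonoid)
  using (xy∙z≈xz∙y)
open import Algebra.Properties.CommutativeSemigroup (CommutativeMonoid.commutativeSemigroup +-0-commutativeMonoid)
  using () renaming (xy∙z≈zy∙x to +-xy∙z≈zy∙x)
import Algebra.Properties.Semiring.Sum (CommutativeRing.semiring +-*-commutativeRing) as Sum
open import Data.Sum using (_⊎_; inj₁; inj₂)
open import Data.Vec using (tabulate)
open import Data.Vec.Properties using (lookup∘tabulate; []=⇒lookup; lookup⇒[]=)
open import Data.Vec.Functional using (_++_; take; drop)
open import Data.Vec.Functional.Properties using (lookup-++ˡ; lookup-++ʳ)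
open import Function using (_∘_; flip; Equivalence)
open import Relation.Binary.PropositionalEquality using (refl; sym; trans; cong; cong₂; subst; _≗_; module ≡-Reasoning)
open import Relation.Nullary using (Dec; yes; no; does; ¬_; contradiction)
open import Relation.Nullary.Decidable using (dec-true; dec-false; dec⇒maybe)
open import Tactic.RingSolver using (solve; solve-∀)
open import Tactic.RingSolver.Core.AlmostCommutativeRing using (AlmostCommutativeRing; fromCommutativeRing)

open ≡-Reasoning
open Equivalence using (to; from)

ℚ-ring : AlmostCommutativeRing _ _
ℚ-ring = fromCommutativeRing +-*-commutativeRing (λ x → dec⇒maybe (0ℚ ≟ x))

÷-spec : ∀ p {q} → q ≢ 0ℚ → (p ÷ q) * q ≡ p
÷-spec p {q} q≢0 with q ≟ 0ℚ
... | yes q≡0 = contradiction q≡0 q≢0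
... | no q≢0′ = begin
  p * 1/ q * q    ≡⟨ *-assoc p (1/ q) q ⟩
  p * (1/ q * q)  ≡⟨ cong (p *_) (*-inverseˡ q) ⟩
  p * 1ℚ          ≡⟨ *-identityʳ p ⟩
  p               ∎
  where
  instance
    nonZero : NonZero q
    nonZero = ≢-nonZero q≢0′

*-cancelʳ-≢0 : ∀ {p q} r → r ≢ 0ℚ → p * r ≡ q * r → p ≡ q
*-cancelʳ-≢0 {p} {q} r r≢0 pr≡qr = begin
  p            ≡⟨ *[r*1/r] p ⟩
  p * r * 1/ r ≡⟨ cong (_* 1/ r) pr≡qr ⟩
  q * r * 1/ r ≡⟨ *[r*1/r] q ⟨
  q            ∎
  where
  instance
    nonZero : NonZero r
    nonZero = ≢-nonZero r≢0
  *[r*1/r] : ∀ x → x ≡ x * r * 1/ r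
  *[r*1/r] x = begin
    x              ≡⟨ *-identityʳ x ⟨
    x * 1ℚ         ≡⟨ cong (x *_) (*-inverseʳ r) ⟨
    x * (r * 1/ r) ≡⟨ *-assoc x r (1/ r) ⟨
    x * r * 1/ r   ∎

÷-unique : ∀ {p q r} → q ≢ 0ℚ → r * q ≡ p → p ÷ q ≡ r
÷-unique {p} q≢0 rq≡p = *-cancelʳ-≢0 _ q≢0 (trans (÷-spec p q≢0) (sym rq≡p))

*-≢0 : ∀ {p q} → p ≢ 0ℚ → q ≢ 0ℚ → p * q ≢ 0ℚ
*-≢0 {q = q} p≢0 q≢0 pq≡0 = p≢0 (*-cancelʳ-≢0 q q≢0 (trans pq≡0 (sym (*-zeroˡ q))))

-≢0 : ∀ {p q} → p ≢ q → p - q ≢ 0ℚ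
-≢0 {p} {q} p≢q p-q≡0 = p≢q (begin
  p           ≡⟨ solve (p ∷ q ∷ []) ℚ-ring ⟩
  (p - q) + q ≡⟨ cong (_+ q) p-q≡0 ⟩
  0ℚ + q      ≡⟨ +-identityˡ q ⟩
  q           ∎)

ℕtoℚ≡mkℚ : ∀ k → ℕtoℚ k ≡ mkℚ (ℤ.+ k) 0 (Coprime.sym (Coprime.1-coprimeTo k))
ℕtoℚ≡mkℚ k = normalize-coprime (Coprime.sym (Coprime.1-coprimeTo k))

ℕtoℚ-suc : ∀ k → ℕtoℚ (suc k) ≡ 1ℚ + ℕtoℚ k
ℕtoℚ-suc k rewrite ℕtoℚ≡mkℚ k | ℕₚ.*-identityʳ k | ℤₚ.+◃n≡+n k = refl

ℕtoℚ-+ : ∀ a b → ℕtoℚ (a ℕ.+ b) ≡ ℕtoℚ a + ℕtoℚ b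
ℕtoℚ-+ zero    b = sym (+-identityˡ (ℕtoℚ b))
ℕtoℚ-+ (suc a) b = begin
  ℕtoℚ (suc (a ℕ.+ b))      ≡⟨ ℕtoℚ-suc (a ℕ.+ b) ⟩
  1ℚ + ℕtoℚ (a ℕ.+ b)       ≡⟨ cong (1ℚ +_) (ℕtoℚ-+ a b) ⟩
  1ℚ + (ℕtoℚ a + ℕtoℚ b)    ≡⟨ +-assoc 1ℚ (ℕtoℚ a) (ℕtoℚ b) ⟨
  1ℚ + ℕtoℚ a + ℕtoℚ b      ≡⟨ cong (_+ ℕtoℚ b) (ℕtoℚ-suc a) ⟨
  ℕtoℚ (suc a) + ℕtoℚ b     ∎

ℕtoℚ-+1+ : ∀ a b → ℕtoℚ (a ℕ.+ 1 ℕ.+ b) ≡ ℕtoℚ a + 1ℚ + ℕtoℚ b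
ℕtoℚ-+1+ a b = trans (ℕtoℚ-+ (a ℕ.+ 1) b) (cong (_+ ℕtoℚ b) (ℕtoℚ-+ a 1))

ℕtoℚ-≢0 : ∀ {k} → 1 ≤ℕ k → ℕtoℚ k ≢ 0ℚ
ℕtoℚ-≢0 {suc k} _ k≡0 with cong ↥_ (trans (sym (ℕtoℚ≡mkℚ (suc k))) k≡0)
... | ()

sumF≡sum : ∀ {n} (f : Fin n → ℚ) → sumF f ≡ Sum.sum f
sumF≡sum {zero}  f = refl
sumF≡sum {suc n} f = cong (f zero +_) (sumF≡sum {n} (f ∘ suc))

sumF-cong : ∀ {n} {f g : Fin n → ℚ} → f ≗ g → sumF f ≡ sumF g
sumF-cong {f = f} {g} f≗g =
  trans (sumF≡sum f) (trans (Sum.sum-cong-≗ f≗g) (sym (sumF≡sum g)))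

sumF-+ : ∀ {n} (f g : Fin n → ℚ) → sumF (λ i → f i + g i) ≡ sumF f + sumF g
sumF-+ f g = trans (sumF≡sum (λ i → f i + g i))
  (trans (Sum.∑-distrib-+ f g) (sym (cong₂ _+_ (sumF≡sum f) (sumF≡sum g))))

*-distribˡ-sumF : ∀ {n} c (f : Fin n → ℚ) → c * sumF f ≡ sumF (λ i → c * f i)
*-distribˡ-sumF c f = trans (cong (c *_) (sumF≡sum f))
  (trans (Sum.*-distribˡ-sum c f) (sym (sumF≡sum (λ i → c * f i))))

*-distribʳ-sumF : ∀ {n} c (f : Fin n → ℚ) → sumF f * c ≡ sumF (λ i → f i * c)
*-distribʳ-sumF c f = trans (cong (_* c) (sumF≡sum f))
  (trans (Sum.*-distribʳ-sum c f) (sym (sumF≡sum (λ i → f i * c))))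

sumF-comm : ∀ {m n} (f : Fin m → Fin n → ℚ) →
            sumF (λ i → sumF (f i)) ≡ sumF (λ j → sumF (λ i → f i j))
sumF-comm f = trans (sumF²≡sum² f) (trans (Sum.∑-comm f) (sym (sumF²≡sum² (flip f))))
  where
  sumF²≡sum² : ∀ {m n} (g : Fin m → Fin n → ℚ) →
               sumF (λ i → sumF (g i)) ≡ Sum.sum (λ i → Sum.sum (g i))
  sumF²≡sum² g = trans (sumF≡sum (λ i → sumF (g i))) (Sum.sum-cong-≗ (λ i → sumF≡sum (g i)))

sumF-splitAt : ∀ {n₁ n₂} (f : Fin (n₁ ℕ.+ n₂) → ℚ) → sumF f ≡ sumF (take n₁ f) + sumF (drop n₁ f)
sumF-splitAt {zero}   f = sym (+-identityˡ (sumF f))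
sumF-splitAt {suc n₁} {n₂} f =
  trans (cong (f zero +_) (sumF-splitAt {n₁} {n₂} (f ∘ suc))) (sym (+-assoc (f zero) _ _))

sumF-idM : ∀ {n} (i : Fin n) (f : Fin n → ℚ) → sumF (λ j → idM i j * f j) ≡ f i
sumF-idM {suc n} zero f = begin
  1ℚ * f zero + sumF (λ j → 0ℚ * f (suc j)) ≡⟨ cong₂ _+_ (*-identityˡ (f zero)) (sym (*-distribˡ-sumF 0ℚ (f ∘ suc))) ⟩
  f zero + 0ℚ * sumF (f ∘ suc)              ≡⟨ cong (f zero +_) (*-zeroˡ (sumF (f ∘ suc))) ⟩
  f zero + 0ℚ                               ≡⟨ +-identityʳ (f zero) ⟩
  f zero                                    ∎
sumF-idM {suc n} (suc i) f =
  trans (cong₂ _+_ (*-zeroˡ (f zero)) (sumF-idM i (f ∘ suc))) (+-identityˡ (f (suc i)))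

sumF-affine : ∀ {n} c (g f : Fin n → ℚ) → sumF (λ j → (c + g j) * f j) ≡ c * sumF f + sumF (λ j → g j * f j)
sumF-affine c g f = begin
  sumF (λ j → (c + g j) * f j)                   ≡⟨ sumF-cong (λ j → *-distribʳ-+ (f j) c (g j)) ⟩
  sumF (λ j → c * f j + g j * f j)               ≡⟨ sumF-+ (λ j → c * f j) (λ j → g j * f j) ⟩
  sumF (λ j → c * f j) + sumF (λ j → g j * f j)  ≡⟨ cong (_+ sumF (λ j → g j * f j)) (*-distribˡ-sumF c f) ⟨
  c * sumF f + sumF (λ j → g j * f j)            ∎

↑-elim : ∀ {m n} {P : Fin (m ℕ.+ n) → Set} → (∀ x → P (x ↑ˡ n)) → (∀ y → P (m ↑ʳ y)) → ∀ t → P t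
↑-elim {m} {P = P} left right t with splitAt m t in eq
... | inj₁ x = subst P (splitAt⁻¹-↑ˡ eq) (left x)
... | inj₂ y = subst P (splitAt⁻¹-↑ʳ eq) (right y)

infixr 7 _·_

_·_ : ∀ {m n} → Matrix m n → (Fin n → ℚ) → Fin m → ℚ
(M · w) i = sumF (λ j → M i j * w j)

·-cong : ∀ {m n} (M : Matrix m n) {f g : Fin n → ℚ} → f ≗ g → M · f ≗ M · g
·-cong M f≗g i = sumF-cong (λ j → cong (M i j *_) (f≗g j))

·-assoc : ∀ {l m n} (A : Matrix l m) (B : Matrix m n) (w : Fin n → ℚ) → A · B · w ≗ (A ⊗ B) · w
·-assoc A B w i = begin
  sumF (λ j → A i j * sumF (λ k → B j k * w k))   ≡⟨ sumF-cong (λ j → *-distribˡ-sumF (A i j) (λ k → B j k * w k)) ⟩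
  sumF (λ j → sumF (λ k → A i j * (B j k * w k))) ≡⟨ sumF-comm (λ j k → A i j * (B j k * w k)) ⟩
  sumF (λ k → sumF (λ j → A i j * (B j k * w k))) ≡⟨ sumF-cong (λ k → sumF-cong (λ j → *-assoc (A i j) (B j k) (w k))) ⟨
  sumF (λ k → sumF (λ j → A i j * B j k * w k))   ≡⟨ sumF-cong (λ k → *-distribʳ-sumF (w k) (λ j → A i j * B j k)) ⟨
  sumF (λ k → (A ⊗ B) i k * w k)                  ∎

·-inverse : ∀ {m n} (A : Matrix m n) (B : Matrix n m) → (A ⊗ B) ≐ idM → ∀ w → A · B · w ≗ w
·-inverse A B AB≐I w i = begin
  (A · B · w) i      ≡⟨ ·-assoc A B w i ⟩
  ((A ⊗ B) · w) i    ≡⟨ sumF-cong (λ k → cong (_* w k) (AB≐I i k)) ⟩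
  sumF (λ k → idM i k * w k) ≡⟨ sumF-idM i w ⟩
  w i                ∎

·-injective : ∀ {n} {D : Matrix n n} → Invertible D → ∀ {f g} → D · f ≗ D · g → f ≗ g
·-injective {D = D} (B , _ , BD≐I) {f} {g} Df≗Dg i = begin
  f i           ≡⟨ ·-inverse B D BD≐I f i ⟨
  (B · D · f) i ≡⟨ ·-cong B Df≗Dg i ⟩
  (B · D · g) i ≡⟨ ·-inverse B D BD≐I g i ⟩
  g i           ∎

invertible⇒solvable : ∀ {n} {D : Matrix n n} → Invertible D → ∃ (Solves D)
invertible⇒solvable {n} {D} (B , DB≐I , _) = B · (λ _ → ℕtoℚ n) , ·-inverse D B DB≐I (λ _ → ℕtoℚ n)

curvature-solves : ∀ {n} {D : Matrix n n} {K} → ∃ (Solves D) → IsCurvatureOf D K → Solves D K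
curvature-solves _          (inj₁ (solves , _))         = solves
curvature-solves _          (inj₂ (inj₁ (solves , _)))  = solves
curvature-solves (K , sol) (inj₂ (inj₂ (unsolvable , _))) = contradiction sol (unsolvable K)

lincomb : ∀ {n} → ℚ → (Fin n → ℚ) → ℚ → Fin n → Fin n → ℚ
lincomb a f b p j = a * f j - b * idM p j

·-lincomb : ∀ {m n} (M : Matrix m n) a f b p i → (M · lincomb a f b p) i ≡ a * (M · f) i - b * M i p
·-lincomb M a f b p i = begin
  sumF (λ j → M i j * (a * f j - b * idM p j))
    ≡⟨ sumF-cong (λ j → distrib (M i j) (f j) (idM p j)) ⟩
  sumF (λ j → a * (M i j * f j) + - b * (idM p j * M i j))
    ≡⟨ sumF-+ (λ j → a * (M i j * f j)) (λ j → - b * (idM p j * M i j)) ⟩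
  sumF (λ j → a * (M i j * f j)) + sumF (λ j → - b * (idM p j * M i j))
    ≡⟨ cong₂ _+_ (*-distribˡ-sumF a (λ j → M i j * f j)) (*-distribˡ-sumF (- b) (λ j → idM p j * M i j)) ⟨
  a * (M · f) i + - b * sumF (λ j → idM p j * M i j)
    ≡⟨ cong (λ x → a * (M · f) i + - b * x) (sumF-idM p (M i)) ⟩
  a * (M · f) i + - b * M i p
    ≡⟨ cong (a * (M · f) i +_) (neg-distribˡ-* b (M i p)) ⟨
  a * (M · f) i - b * M i p ∎
  where
  distrib : ∀ m x d → m * (a * x - b * d) ≡ a * (m * x) + - b * (d * m)
  distrib m x d = solve (m ∷ x ∷ d ∷ a ∷ b ∷ []) ℚ-ring

sumF-lincomb : ∀ {n} a (f : Fin n → ℚ) b p → sumF (lincomb a f b p) ≡ a * sumF f - b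
sumF-lincomb {n} a f b p = begin
  sumF (lincomb a f b p)         ≡⟨ sumF-cong (λ j → *-identityˡ (lincomb a f b p j)) ⟨
  (ones · lincomb a f b p) zero  ≡⟨ ·-lincomb ones a f b p zero ⟩
  a * (ones · f) zero - b * 1ℚ   ≡⟨ cong₂ (λ x y → a * x - y) (sumF-cong (λ j → *-identityˡ (f j))) (*-identityʳ b) ⟩
  a * sumF f - b                 ∎
  where
  ones : Matrix 1 n
  ones _ _ = 1ℚ

idM-diag : ∀ {n} (p : Fin n) → idM p p ≡ 1ℚ
idM-diag p rewrite dec-true (p ≟ᶠ p) refl = refl

idM-offdiag : ∀ {n} {p q : Fin n} → p ≢ q → idM p q ≡ 0ℚ
idM-offdiag {p = p} {q} p≢q rewrite dec-false (p ≟ᶠ q) p≢q = refl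

x-y*0≡x : ∀ x y → x - y * 0ℚ ≡ x
x-y*0≡x x y = solve (x ∷ y ∷ []) ℚ-ring

lincomb-diag : ∀ {n} a (f : Fin n → ℚ) b p → lincomb a f b p p ≡ a * f p - b
lincomb-diag a f b p =
  trans (cong (λ d → a * f p - b * d) (idM-diag p)) (cong (λ x → a * f p - x) (*-identityʳ b))

lincomb-offdiag : ∀ {n} a (f : Fin n → ℚ) b {p j} → p ≢ j → lincomb a f b p j ≡ a * f j
lincomb-offdiag a f b {p} {j} p≢j =
  trans (cong (λ d → a * f j - b * d) (idM-offdiag p≢j)) (x-y*0≡x (a * f j) b)

lincomb-diag-½ : ∀ {n} P (f : Fin n → ℚ) p → f p ≢ 0ℚ →
                 lincomb P f (P * sumF f * ½) p p ≡ (ℕtoℚ 1 - sumF f ÷ (ℕtoℚ 2 * f p)) * P * f p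
lincomb-diag-½ P f p fp≢0 = begin
  lincomb P f (P * k * ½) p p             ≡⟨ lincomb-diag P f (P * k * ½) p ⟩
  P * f p - P * k * ½                     ≡⟨ cong (λ y → P * f p - P * y * ½) (÷-spec k 2fp≢0) ⟨
  P * f p - P * (r * (ℕtoℚ 2 * f p)) * ½  ≡⟨ regroup P (f p) r ⟩
  (ℕtoℚ 1 - r) * P * f p                  ∎
  where
  k r : ℚ
  k = sumF f
  r = k ÷ (ℕtoℚ 2 * f p)
  2fp≢0 : ℕtoℚ 2 * f p ≢ 0ℚ
  2fp≢0 = *-≢0 {ℕtoℚ 2} (λ ()) fp≢0
  regroup : ∀ P a r → P * a - P * (r * (ℕtoℚ 2 * a)) * ½ ≡ (ℕtoℚ 1 - r) * P * a
  regroup = solve-∀ ℚ-ring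

·-lincomb-solves : ∀ {m} {D : Matrix m m} {K} → Solves D K →
                   ∀ a b p i → (D · lincomb a K b p) i ≡ a * ℕtoℚ m - b * D i p
·-lincomb-solves {D = D} {K} sol a b p i =
  trans (·-lincomb D a K b p i) (cong (λ x → a * x - b * D i p) (sol i))

·-shifted-solution : ∀ {m} {D : Matrix m m} {K} → Invertible D → Solves D K → ℕtoℚ m ≢ 0ℚ →
                     ∀ {w c b p} → (∀ i → (D · w) i ≡ c - b * D i p) → w ≗ lincomb (c ÷ ℕtoℚ m) K b p
·-shifted-solution {m} {D} {K} inv sol m≢0 {w} {c} {b} {p} Dw≡ = ·-injective inv λ i → begin
  (D · w) i                           ≡⟨ Dw≡ i ⟩
  c - b * D i p                       ≡⟨ cong (λ x → x - b * D i p) (÷-spec c m≢0) ⟨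
  (c ÷ ℕtoℚ m) * ℕtoℚ m - b * D i p   ≡⟨ ·-lincomb-solves {D = D} sol (c ÷ ℕtoℚ m) b p i ⟨
  (D · lincomb (c ÷ ℕtoℚ m) K b p) i  ∎

module Scaling (n n₁ n₂ k₁ k₂ : ℚ) where

  Z : ℚ
  Z = (ℕtoℚ 2 + k₁ ÷ n₁) * (ℕtoℚ 2 + k₂ ÷ n₂)

  α β : ℚ
  α = (ℕtoℚ 2 * n * k₂) ÷ (n₁ * n₂ * (Z - ℕtoℚ 4))
  β = (ℕtoℚ 2 * n * k₁) ÷ (n₁ * n₂ * (Z - ℕtoℚ 4))

  Balanced : ℚ → ℚ → Set
  Balanced P₁ P₂ = P₁ * k₁ ≡ P₂ * k₂ × P₁ * n₁ + P₁ * k₁ * ½ + P₂ * n₂ ≡ n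

  -- Twice the determinant of the system Balanced in (P₁, P₂); equal to n₁ n₂ (Z − 4).
  Δ : ℚ
  Δ = k₁ * k₂ + ℕtoℚ 2 * (n₁ * k₂ + n₂ * k₁)

  balanced⇒scaled : ∀ {P₁ P₂} → Balanced P₁ P₂ → P₁ * Δ ≡ ℕtoℚ 2 * n * k₂ × P₂ * Δ ≡ ℕtoℚ 2 * n * k₁
  balanced⇒scaled {P₁} {P₂} (P₁k₁≡P₂k₂ , total) = P₁-scaled , P₂-scaled
    where
    P₁-scaled : P₁ * Δ ≡ ℕtoℚ 2 * n * k₂
    P₁-scaled = begin
      P₁ * (k₁ * k₂ + ℕtoℚ 2 * (n₁ * k₂ + n₂ * k₁))
        ≡⟨ solve (P₁ ∷ n₁ ∷ n₂ ∷ k₁ ∷ k₂ ∷ []) ℚ-ring ⟩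
      ℕtoℚ 2 * k₂ * (P₁ * n₁ + P₁ * k₁ * ½) + ℕtoℚ 2 * n₂ * (P₁ * k₁)
        ≡⟨ cong (λ x → ℕtoℚ 2 * k₂ * (P₁ * n₁ + P₁ * k₁ * ½) + ℕtoℚ 2 * n₂ * x) P₁k₁≡P₂k₂ ⟩
      ℕtoℚ 2 * k₂ * (P₁ * n₁ + P₁ * k₁ * ½) + ℕtoℚ 2 * n₂ * (P₂ * k₂)
        ≡⟨ solve (P₁ ∷ P₂ ∷ n₁ ∷ n₂ ∷ k₁ ∷ k₂ ∷ []) ℚ-ring ⟩
      ℕtoℚ 2 * k₂ * (P₁ * n₁ + P₁ * k₁ * ½ + P₂ * n₂)
        ≡⟨ cong (ℕtoℚ 2 * k₂ *_) total ⟩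
      ℕtoℚ 2 * k₂ * n
        ≡⟨ solve (n ∷ k₂ ∷ []) ℚ-ring ⟩
      ℕtoℚ 2 * n * k₂ ∎
    P₂-scaled : P₂ * Δ ≡ ℕtoℚ 2 * n * k₁
    P₂-scaled = begin
      P₂ * (k₁ * k₂ + ℕtoℚ 2 * (n₁ * k₂ + n₂ * k₁))
        ≡⟨ solve (P₂ ∷ n₁ ∷ n₂ ∷ k₁ ∷ k₂ ∷ []) ℚ-ring ⟩
      P₂ * k₂ * (k₁ + ℕtoℚ 2 * n₁) + ℕtoℚ 2 * k₁ * (P₂ * n₂)
        ≡⟨ cong (λ x → x * (k₁ + ℕtoℚ 2 * n₁) + ℕtoℚ 2 * k₁ * (P₂ * n₂)) P₁k₁≡P₂k₂ ⟨
      P₁ * k₁ * (k₁ + ℕtoℚ 2 * n₁) + ℕtoℚ 2 * k₁ * (P₂ * n₂)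
        ≡⟨ solve (P₁ ∷ P₂ ∷ n₁ ∷ n₂ ∷ k₁ ∷ []) ℚ-ring ⟩
      ℕtoℚ 2 * k₁ * (P₁ * n₁ + P₁ * k₁ * ½ + P₂ * n₂)
        ≡⟨ cong (ℕtoℚ 2 * k₁ *_) total ⟩
      ℕtoℚ 2 * k₁ * n
        ≡⟨ solve (n ∷ k₁ ∷ []) ℚ-ring ⟩
      ℕtoℚ 2 * n * k₁ ∎

  scaled⇒balanced : ∀ {P₁ P₂} → Δ ≢ 0ℚ → P₁ * Δ ≡ ℕtoℚ 2 * n * k₂ → P₂ * Δ ≡ ℕtoℚ 2 * n * k₁ →
                    Balanced P₁ P₂
  scaled⇒balanced {P₁} {P₂} Δ≢0 P₁Δ≡ P₂Δ≡ = *-cancelʳ-≢0 Δ Δ≢0 ratio , *-cancelʳ-≢0 Δ Δ≢0 total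
    where
    ratio : P₁ * k₁ * Δ ≡ P₂ * k₂ * Δ
    ratio = begin
      P₁ * k₁ * Δ           ≡⟨ xy∙z≈xz∙y P₁ k₁ Δ ⟩
      P₁ * Δ * k₁           ≡⟨ cong (_* k₁) P₁Δ≡ ⟩
      ℕtoℚ 2 * n * k₂ * k₁  ≡⟨ xy∙z≈xz∙y (ℕtoℚ 2 * n) k₂ k₁ ⟩
      ℕtoℚ 2 * n * k₁ * k₂  ≡⟨ cong (_* k₂) P₂Δ≡ ⟨
      P₂ * Δ * k₂           ≡⟨ xy∙z≈xz∙y P₂ Δ k₂ ⟩
      P₂ * k₂ * Δ           ∎
    total : (P₁ * n₁ + P₁ * k₁ * ½ + P₂ * n₂) * Δ ≡ n * Δ
    total = begin
      (P₁ * n₁ + P₁ * k₁ * ½ + P₂ * n₂) * Δ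
        ≡⟨ regroup Δ ⟩
      (n₁ + k₁ * ½) * (P₁ * Δ) + n₂ * (P₂ * Δ)
        ≡⟨ cong₂ (λ x y → (n₁ + k₁ * ½) * x + n₂ * y) P₁Δ≡ P₂Δ≡ ⟩
      (n₁ + k₁ * ½) * (ℕtoℚ 2 * n * k₂) + n₂ * (ℕtoℚ 2 * n * k₁)
        ≡⟨ solve (n ∷ n₁ ∷ n₂ ∷ k₁ ∷ k₂ ∷ []) ℚ-ring ⟩
      n * (k₁ * k₂ + ℕtoℚ 2 * (n₁ * k₂ + n₂ * k₁)) ∎
      where
      regroup : ∀ d → (P₁ * n₁ + P₁ * k₁ * ½ + P₂ * n₂) * d ≡ (n₁ + k₁ * ½) * (P₁ * d) + n₂ * (P₂ * d)
      regroup d = solve (d ∷ P₁ ∷ P₂ ∷ n₁ ∷ n₂ ∷ k₁ ∷ []) ℚ-ring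

  block-sums : ∀ {P₁ P₂ s₁ s₂ t₁ t₂} →
    P₁ * n₁ ≡ n - s₂ - t₂ → P₂ * n₂ ≡ n - s₁ - t₁ →
    t₁ ≡ n - s₂ - t₂ → t₂ ≡ n - s₁ - t₁ →
    s₁ ≡ P₁ * k₁ - s₂ → s₂ ≡ P₂ * k₂ - s₁ →
    s₁ ≡ P₁ * k₁ * ½ × s₂ ≡ P₁ * k₁ * ½ × Balanced P₁ P₂
  block-sums {P₁} {P₂} {s₁} {s₂} {t₁} {t₂} P₁n₁≡ P₂n₂≡ t₁≡ t₂≡ s₁≡ s₂≡ =
    trans s₁≡s₂ s₂≡half , s₂≡half , ratio , total
    where
    s₁≡s₂ : s₁ ≡ s₂
    s₁≡s₂ = begin
      s₁                     ≡⟨ solve (n ∷ s₁ ∷ t₁ ∷ []) ℚ-ring ⟩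
      n - t₁ - (n - s₁ - t₁) ≡⟨ cong (λ x → n - t₁ - x) t₂≡ ⟨
      n - t₁ - t₂            ≡⟨ cong (λ x → n - x - t₂) t₁≡ ⟩
      n - (n - s₂ - t₂) - t₂ ≡⟨ solve (n ∷ s₂ ∷ t₂ ∷ []) ℚ-ring ⟩
      s₂                     ∎
    doubled : ∀ P k {s s′} → s′ ≡ P * k - s → s′ ≡ s → P * k ≡ s + s
    doubled P k {s} s′≡ s′≡s = begin
      P * k           ≡⟨ solve (P ∷ k ∷ s ∷ []) ℚ-ring ⟩
      (P * k - s) + s ≡⟨ cong (_+ s) (trans (sym s′≡) s′≡s) ⟩
      s + s           ∎
    s₂≡half : s₂ ≡ P₁ * k₁ * ½
    s₂≡half = begin
      s₂             ≡⟨ solve (s₂ ∷ []) ℚ-ring ⟩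
      (s₂ + s₂) * ½  ≡⟨ cong (_* ½) (doubled P₁ k₁ s₁≡ s₁≡s₂) ⟨
      P₁ * k₁ * ½    ∎
    ratio : P₁ * k₁ ≡ P₂ * k₂
    ratio = begin
      P₁ * k₁  ≡⟨ doubled P₁ k₁ s₁≡ s₁≡s₂ ⟩
      s₂ + s₂  ≡⟨ cong₂ _+_ s₁≡s₂ s₁≡s₂ ⟨
      s₁ + s₁  ≡⟨ doubled P₂ k₂ s₂≡ (sym s₁≡s₂) ⟨
      P₂ * k₂  ∎
    total : P₁ * n₁ + P₁ * k₁ * ½ + P₂ * n₂ ≡ n
    total = begin
      P₁ * n₁ + P₁ * k₁ * ½ + P₂ * n₂  ≡⟨ cong₂ (λ a b → a + b + P₂ * n₂) P₁n₁≡ (sym s₂≡half) ⟩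
      (n - s₂ - t₂) + s₂ + P₂ * n₂     ≡⟨ cong (λ x → (n - s₂ - t₂) + s₂ + x) (trans P₂n₂≡ (sym t₂≡)) ⟩
      (n - s₂ - t₂) + s₂ + t₂          ≡⟨ solve (n ∷ s₂ ∷ t₂ ∷ []) ℚ-ring ⟩
      n                                ∎

  module _ (n₁≢0 : n₁ ≢ 0ℚ) (n₂≢0 : n₂ ≢ 0ℚ) (Z≢4 : Z ≢ ℕtoℚ 4) where

    denominator≡Δ : n₁ * n₂ * (Z - ℕtoℚ 4) ≡ Δ
    denominator≡Δ = begin
      n₁ * n₂ * (Z - ℕtoℚ 4)
        ≡⟨ expand (k₁ ÷ n₁) (k₂ ÷ n₂) ⟩
      (k₁ ÷ n₁) * n₁ * ((k₂ ÷ n₂) * n₂) + ℕtoℚ 2 * (n₁ * ((k₂ ÷ n₂) * n₂) + n₂ * ((k₁ ÷ n₁) * n₁))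
        ≡⟨ cong₂ (λ a b → a * b + ℕtoℚ 2 * (n₁ * b + n₂ * a)) (÷-spec k₁ n₁≢0) (÷-spec k₂ n₂≢0) ⟩
      Δ ∎
      where
      expand : ∀ a b → n₁ * n₂ * ((ℕtoℚ 2 + a) * (ℕtoℚ 2 + b) - ℕtoℚ 4) ≡
                       a * n₁ * (b * n₂) + ℕtoℚ 2 * (n₁ * (b * n₂) + n₂ * (a * n₁))
      expand a b = solve (a ∷ b ∷ n₁ ∷ n₂ ∷ []) ℚ-ring

    Δ≢0 : Δ ≢ 0ℚ
    Δ≢0 = subst (_≢ 0ℚ) denominator≡Δ (*-≢0 (*-≢0 n₁≢0 n₂≢0) (-≢0 Z≢4))

    balanced-unique : ∀ {P₁ P₂} → Balanced P₁ P₂ → P₁ ≡ α × P₂ ≡ β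
    balanced-unique {P₁} {P₂} bal =
      sym (trans (cong (_ ÷_) denominator≡Δ) (÷-unique Δ≢0 (proj₁ (balanced⇒scaled {P₁} {P₂} bal)))) ,
      sym (trans (cong (_ ÷_) denominator≡Δ) (÷-unique Δ≢0 (proj₂ (balanced⇒scaled {P₁} {P₂} bal))))

    balanced-α-β : Balanced α β
    balanced-α-β = scaled⇒balanced {α} {β} Δ≢0
      (trans (cong (λ d → (ℕtoℚ 2 * n * k₂) ÷ d * Δ) denominator≡Δ) (÷-spec _ Δ≢0))
      (trans (cong (λ d → (ℕtoℚ 2 * n * k₁) ÷ d * Δ) denominator≡Δ) (÷-spec _ Δ≢0))

record IsBridgeMatrix {n₁ n₂} (D₁ : Matrix n₁ n₁) (D₂ : Matrix n₂ n₂) (u : Fin n₁) (v : Fin n₂)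
                      (D : Matrix (n₁ ℕ.+ n₂) (n₁ ℕ.+ n₂)) : Set where
  field
    ↑ˡ-↑ˡ : ∀ x z → D (x ↑ˡ n₂) (z ↑ˡ n₂) ≡ D₁ x z
    ↑ˡ-↑ʳ : ∀ x w → D (x ↑ˡ n₂) (n₁ ↑ʳ w) ≡ D₁ x u + 1ℚ + D₂ v w
    ↑ʳ-↑ˡ : ∀ y z → D (n₁ ↑ʳ y) (z ↑ˡ n₂) ≡ D₂ y v + 1ℚ + D₁ u z
    ↑ʳ-↑ʳ : ∀ y w → D (n₁ ↑ʳ y) (n₁ ↑ʳ w) ≡ D₂ y w

  row-↑ˡ : ∀ W x → (D · W) (x ↑ˡ n₂) ≡
           (D₁ · take n₁ W) x + (D₁ x u + 1ℚ) * sumF (drop n₁ W) + (D₂ · drop n₁ W) v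
  row-↑ˡ W x = begin
    (D · W) (x ↑ˡ n₂)
      ≡⟨ sumF-splitAt {n₁} (λ t → D (x ↑ˡ n₂) t * W t) ⟩
    sumF (λ z → D (x ↑ˡ n₂) (z ↑ˡ n₂) * W (z ↑ˡ n₂)) + sumF (λ w → D (x ↑ˡ n₂) (n₁ ↑ʳ w) * W (n₁ ↑ʳ w))
      ≡⟨ cong₂ _+_ (sumF-cong (λ z → cong (_* W (z ↑ˡ n₂)) (↑ˡ-↑ˡ x z)))
                   (sumF-cong (λ w → cong (_* W (n₁ ↑ʳ w)) (↑ˡ-↑ʳ x w))) ⟩
    (D₁ · take n₁ W) x + sumF (λ w → (D₁ x u + 1ℚ + D₂ v w) * drop n₁ W w)
      ≡⟨ cong ((D₁ · take n₁ W) x +_) (sumF-affine (D₁ x u + 1ℚ) (D₂ v) (drop n₁ W)) ⟩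
    (D₁ · take n₁ W) x + ((D₁ x u + 1ℚ) * sumF (drop n₁ W) + (D₂ · drop n₁ W) v)
      ≡⟨ +-assoc ((D₁ · take n₁ W) x) _ _ ⟨
    (D₁ · take n₁ W) x + (D₁ x u + 1ℚ) * sumF (drop n₁ W) + (D₂ · drop n₁ W) v ∎

  row-↑ʳ : ∀ W y → (D · W) (n₁ ↑ʳ y) ≡
           (D₂ · drop n₁ W) y + (D₂ y v + 1ℚ) * sumF (take n₁ W) + (D₁ · take n₁ W) u
  row-↑ʳ W y = begin
    (D · W) (n₁ ↑ʳ y)
      ≡⟨ sumF-splitAt {n₁} (λ t → D (n₁ ↑ʳ y) t * W t) ⟩
    sumF (λ z → D (n₁ ↑ʳ y) (z ↑ˡ n₂) * W (z ↑ˡ n₂)) + sumF (λ w → D (n₁ ↑ʳ y) (n₁ ↑ʳ w) * W (n₁ ↑ʳ w))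
      ≡⟨ +-comm (sumF (λ z → D (n₁ ↑ʳ y) (z ↑ˡ n₂) * W (z ↑ˡ n₂))) _ ⟩
    sumF (λ w → D (n₁ ↑ʳ y) (n₁ ↑ʳ w) * W (n₁ ↑ʳ w)) + sumF (λ z → D (n₁ ↑ʳ y) (z ↑ˡ n₂) * W (z ↑ˡ n₂))
      ≡⟨ cong₂ _+_ (sumF-cong (λ w → cong (_* W (n₁ ↑ʳ w)) (↑ʳ-↑ʳ y w)))
                   (sumF-cong (λ z → cong (_* W (z ↑ˡ n₂)) (↑ʳ-↑ˡ y z))) ⟩
    (D₂ · drop n₁ W) y + sumF (λ z → (D₂ y v + 1ℚ + D₁ u z) * take n₁ W z)
      ≡⟨ cong ((D₂ · drop n₁ W) y +_) (sumF-affine (D₂ y v + 1ℚ) (D₁ u) (take n₁ W)) ⟩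
    (D₂ · drop n₁ W) y + ((D₂ y v + 1ℚ) * sumF (take n₁ W) + (D₁ · take n₁ W) u)
      ≡⟨ +-assoc ((D₂ · drop n₁ W) y) _ _ ⟨
    (D₂ · drop n₁ W) y + (D₂ y v + 1ℚ) * sumF (take n₁ W) + (D₁ · take n₁ W) u ∎

bridge-row : ∀ a b c P k {X S T} → X ≡ a - P * k * ½ * c → S ≡ P * k - P * k * ½ → T ≡ b →
             X + (c + 1ℚ) * S + T ≡ a + P * k * ½ + b
bridge-row a b c P k refl refl refl = solve (a ∷ b ∷ c ∷ P ∷ k ∷ []) ℚ-ring

vanishing-diag : ∀ x y {d} → d ≡ 0ℚ → x - y * d ≡ x
vanishing-diag x y refl = x-y*0≡x x y

isolate-row : ∀ {X c S T N} → X + (c + 1ℚ) * S + T ≡ N → X ≡ N - S - T - S * c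
isolate-row {X} {c} {S} {T} {N} row = begin
  X                                       ≡⟨ solve (X ∷ c ∷ S ∷ T ∷ []) ℚ-ring ⟩
  X + (c + 1ℚ) * S + T - S - T - S * c    ≡⟨ cong (λ y → y - S - T - S * c) row ⟩
  N - S - T - S * c                       ∎

module BridgeSystem {n₁ n₂} {D₁ : Matrix n₁ n₁} {D₂ : Matrix n₂ n₂} {u v D}
                    (bm : IsBridgeMatrix D₁ D₂ u v D)
                    {K₁ K₂} (sol₁ : Solves D₁ K₁) (sol₂ : Solves D₂ K₂)
                    (D₁uu≡0 : D₁ u u ≡ 0ℚ) (D₂vv≡0 : D₂ v v ≡ 0ℚ) where

  open IsBridgeMatrix bm
  open Scaling (ℕtoℚ (n₁ ℕ.+ n₂)) (ℕtoℚ n₁) (ℕtoℚ n₂) (sumF K₁) (sumF K₂)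

  bridgeVector : ℚ → ℚ → ℚ → Fin (n₁ ℕ.+ n₂) → ℚ
  bridgeVector P₁ P₂ s = lincomb P₁ K₁ s u ++ lincomb P₂ K₂ s v

  balanced-solves : ∀ {P₁ P₂} → Balanced P₁ P₂ → Solves D (bridgeVector P₁ P₂ (P₁ * sumF K₁ * ½))
  balanced-solves {P₁} {P₂} (P₁k₁≡P₂k₂ , total) = ↑-elim on-V₁ on-V₂
    where
    s : ℚ
    s = P₁ * sumF K₁ * ½
    V : Fin (n₁ ℕ.+ n₂) → ℚ
    V = bridgeVector P₁ P₂ s
    V₁≗ : take n₁ V ≗ lincomb P₁ K₁ s u
    V₁≗ = lookup-++ˡ (lincomb P₁ K₁ s u) (lincomb P₂ K₂ s v)
    V₂≗ : drop n₁ V ≗ lincomb P₂ K₂ s v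
    V₂≗ = lookup-++ʳ (lincomb P₁ K₁ s u) (lincomb P₂ K₂ s v)
    D₁V₁ : ∀ x → (D₁ · take n₁ V) x ≡ P₁ * ℕtoℚ n₁ - s * D₁ x u
    D₁V₁ x = trans (·-cong D₁ V₁≗ x) (·-lincomb-solves {D = D₁} sol₁ P₁ s u x)
    D₂V₂ : ∀ y → (D₂ · drop n₁ V) y ≡ P₂ * ℕtoℚ n₂ - s * D₂ y v
    D₂V₂ y = trans (·-cong D₂ V₂≗ y) (·-lincomb-solves {D = D₂} sol₂ P₂ s v y)
    ΣV₁ : sumF (take n₁ V) ≡ P₁ * sumF K₁ - s
    ΣV₁ = trans (sumF-cong V₁≗) (sumF-lincomb P₁ K₁ s u)
    ΣV₂ : sumF (drop n₁ V) ≡ P₁ * sumF K₁ - s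
    ΣV₂ = trans (sumF-cong V₂≗) (trans (sumF-lincomb P₂ K₂ s v) (cong (_- s) (sym P₁k₁≡P₂k₂)))
    on-V₁ : ∀ x → (D · V) (x ↑ˡ n₂) ≡ ℕtoℚ (n₁ ℕ.+ n₂)
    on-V₁ x = trans (row-↑ˡ V x)
      (trans (bridge-row (P₁ * ℕtoℚ n₁) (P₂ * ℕtoℚ n₂) (D₁ x u) P₁ (sumF K₁)
                         (D₁V₁ x) ΣV₂ (trans (D₂V₂ v) (vanishing-diag (P₂ * ℕtoℚ n₂) s D₂vv≡0)))
             total)
    on-V₂ : ∀ y → (D · V) (n₁ ↑ʳ y) ≡ ℕtoℚ (n₁ ℕ.+ n₂)
    on-V₂ y = trans (row-↑ʳ V y)
      (trans (bridge-row (P₂ * ℕtoℚ n₂) (P₁ * ℕtoℚ n₁) (D₂ y v) P₁ (sumF K₁)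
                         (D₂V₂ y) ΣV₁ (trans (D₁V₁ u) (vanishing-diag (P₁ * ℕtoℚ n₁) s D₁uu≡0)))
             (trans (+-xy∙z≈zy∙x (P₂ * ℕtoℚ n₂) s (P₁ * ℕtoℚ n₁)) total))

  record BlockForm (K : Fin (n₁ ℕ.+ n₂) → ℚ) : Set where
    field
      P₁ P₂    : ℚ
      balanced : Balanced P₁ P₂
      on-V₁    : take n₁ K ≗ lincomb P₁ K₁ (P₁ * sumF K₁ * ½) u
      on-V₂    : drop n₁ K ≗ lincomb P₂ K₂ (P₁ * sumF K₁ * ½) v

  module _ (inv₁ : Invertible D₁) (inv₂ : Invertible D₂) (n₁≢0 : ℕtoℚ n₁ ≢ 0ℚ) (n₂≢0 : ℕtoℚ n₂ ≢ 0ℚ) where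

    solution-blockForm : ∀ {K} → Solves D K → BlockForm K
    solution-blockForm {K} sol = record
      { P₁ = P₁ ; P₂ = P₂ ; balanced = balanced
      ; on-V₁ = λ x → trans (shape₁ x) (cong (λ s → lincomb P₁ K₁ s u x) s₂≡s)
      ; on-V₂ = λ y → trans (shape₂ y) (cong (λ s → lincomb P₂ K₂ s v y) s₁≡s)
      }
      where
      N s₁ s₂ t₁ t₂ P₁ P₂ : ℚ
      N  = ℕtoℚ (n₁ ℕ.+ n₂)
      s₁ = sumF (take n₁ K)
      s₂ = sumF (drop n₁ K)
      t₁ = (D₁ · take n₁ K) u
      t₂ = (D₂ · drop n₁ K) v
      P₁ = (N - s₂ - t₂) ÷ ℕtoℚ n₁
      P₂ = (N - s₁ - t₁) ÷ ℕtoℚ n₂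
      D₁K₁ : ∀ x → (D₁ · take n₁ K) x ≡ N - s₂ - t₂ - s₂ * D₁ x u
      D₁K₁ x = isolate-row (trans (sym (row-↑ˡ K x)) (sol (x ↑ˡ n₂)))
      D₂K₂ : ∀ y → (D₂ · drop n₁ K) y ≡ N - s₁ - t₁ - s₁ * D₂ y v
      D₂K₂ y = isolate-row (trans (sym (row-↑ʳ K y)) (sol (n₁ ↑ʳ y)))
      shape₁ : take n₁ K ≗ lincomb P₁ K₁ s₂ u
      shape₁ = ·-shifted-solution {D = D₁} inv₁ sol₁ n₁≢0 {b = s₂} {u} D₁K₁
      shape₂ : drop n₁ K ≗ lincomb P₂ K₂ s₁ v
      shape₂ = ·-shifted-solution {D = D₂} inv₂ sol₂ n₂≢0 {b = s₁} {v} D₂K₂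
      t₁≡ : t₁ ≡ N - s₂ - t₂
      t₁≡ = trans (D₁K₁ u) (vanishing-diag (N - s₂ - t₂) s₂ D₁uu≡0)
      t₂≡ : t₂ ≡ N - s₁ - t₁
      t₂≡ = trans (D₂K₂ v) (vanishing-diag (N - s₁ - t₁) s₁ D₂vv≡0)
      sums : s₁ ≡ P₁ * sumF K₁ * ½ × s₂ ≡ P₁ * sumF K₁ * ½ × Balanced P₁ P₂
      sums = block-sums {P₁} {P₂} (÷-spec _ n₁≢0) (÷-spec _ n₂≢0) t₁≡ t₂≡
               (trans (sumF-cong shape₁) (sumF-lincomb P₁ K₁ s₂ u))
               (trans (sumF-cong shape₂) (sumF-lincomb P₂ K₂ s₁ v))
      s₁≡s : s₁ ≡ P₁ * sumF K₁ * ½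
      s₁≡s = proj₁ sums
      s₂≡s : s₂ ≡ P₁ * sumF K₁ * ½
      s₂≡s = proj₁ (proj₂ sums)
      balanced : Balanced P₁ P₂
      balanced = proj₂ (proj₂ sums)

    bridge-curvature : Z ≢ ℕtoℚ 4 → ∀ {K} → IsCurvatureOf D K →
                       take n₁ K ≗ lincomb α K₁ (α * sumF K₁ * ½) u ×
                       drop n₁ K ≗ lincomb β K₂ (β * sumF K₂ * ½) v
    bridge-curvature Z≢4 {K} curv = on-V₁′ , on-V₂′
      where
      open BlockForm (solution-blockForm (curvature-solves (_ , balanced-solves {α} {β} (balanced-α-β n₁≢0 n₂≢0 Z≢4)) curv))
      P≡αβ : P₁ ≡ α × P₂ ≡ β
      P≡αβ = balanced-unique n₁≢0 n₂≢0 Z≢4 {P₁} {P₂} balanced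
      on-V₁′ : take n₁ K ≗ lincomb α K₁ (α * sumF K₁ * ½) u
      on-V₁′ x = trans (on-V₁ x) (cong (λ P → lincomb P K₁ (P * sumF K₁ * ½) u x) (proj₁ P≡αβ))
      on-V₂′ : drop n₁ K ≗ lincomb β K₂ (β * sumF K₂ * ½) v
      on-V₂′ y = trans (on-V₂ y) (trans (cong (λ s → lincomb P₂ K₂ (s * ½) v y) (proj₁ balanced))
                                        (cong (λ P → lincomb P K₂ (P * sumF K₂ * ½) v y) (proj₂ P≡αβ)))

record Adj {n} (G : Graph n) (x y : Fin n) : Set where
  constructor edge
  field adjacent : T (adj G x y)

record Reach {n} (G : Graph n) (k : ℕ) (x y : Fin n) : Set where
  constructor walk
  field reaches : T (reach G k x y)

T-does⇒ : ∀ {A : Set} (a? : Dec A) → T (does a?) → A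
T-does⇒ (yes a) _ = a

anyF⁻ : ∀ {n} (p : Fin n → Bool) → T (anyF p) → ∃ λ i → T (p i)
anyF⁻ {suc n} p t with to T-∨ t
... | inj₁ t₀ = zero , t₀
... | inj₂ t′ with anyF⁻ (p ∘ suc) t′
...   | i , tᵢ = suc i , tᵢ

anyF⁺ : ∀ {n} (p : Fin n → Bool) i → T (p i) → T (anyF p)
anyF⁺ p zero    t = from T-∨ (inj₁ t)
anyF⁺ p (suc i) t = from T-∨ (inj₂ (anyF⁺ (p ∘ suc) i t))

module _ {n} (G : Graph n) where

  reach-zero⁻ : ∀ {x y} → Reach G 0 x y → x ≡ y
  reach-zero⁻ {x} {y} (walk r) = T-does⇒ (x ≟ᶠ y) r

  reach-zero⁺ : ∀ {x} → Reach G 0 x x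
  reach-zero⁺ {x} = walk (from T-≡ (dec-true (x ≟ᶠ x) refl))

  reach-suc⁻ : ∀ {k x y} → Reach G (suc k) x y → Reach G k x y ⊎ ∃ λ z → Reach G k x z × Adj G z y
  reach-suc⁻ {k} {x} {y} (walk r) with to T-∨ r
  ... | inj₁ r′ = inj₁ (walk r′)
  ... | inj₂ t with anyF⁻ (λ z → reach G k x z ∧ adj G z y) t
  ...   | z , t′ with to T-∧ t′
  ...     | r′ , e = inj₂ (z , walk r′ , edge e)

  reach-weaken : ∀ {k x y} → Reach G k x y → Reach G (suc k) x y
  reach-weaken (walk r) = walk (from T-∨ (inj₁ r))

  reach-step : ∀ {k x y z} → Reach G k x y → Adj G y z → Reach G (suc k) x z
  reach-step {k} {x} {y} {z} (walk r) (edge e) =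
    walk (from T-∨ (inj₂ (anyF⁺ (λ w → reach G k x w ∧ adj G w z) y (from T-∧ (r , e)))))

  reach-mono : ∀ {k m x y} → k ≤ℕ m → Reach G k x y → Reach G m x y
  reach-mono {k} {x = x} {y} k≤m r = go (ℕₚ.≤⇒≤′ k≤m)
    where
    go : ∀ {m} → k ℕ.≤′ m → Reach G m x y
    go ℕ.≤′-refl        = r
    go (ℕ.≤′-step k≤′m) = reach-weaken (go k≤′m)

  reach-edge : ∀ {x y} → Adj G x y → Reach G 1 x y
  reach-edge = reach-step reach-zero⁺

  reach-trans : ∀ {a b x y z} → Reach G a x y → Reach G b y z → Reach G (a ℕ.+ b) x z
  reach-trans {a} {zero} {x} r r′ rewrite ℕₚ.+-identityʳ a = subst (Reach G a x) (reach-zero⁻ r′) r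
  reach-trans {a} {suc b} r r′ rewrite ℕₚ.+-suc a b with reach-suc⁻ r′
  ... | inj₁ r″            = reach-weaken (reach-trans r r″)
  ... | inj₂ (_ , r″ , e)  = reach-step (reach-trans r r″) e

  Lipschitz : (Fin n → ℕ) → Set
  Lipschitz φ = ∀ {a b} → Adj G a b → φ b ≤ℕ suc (φ a)

  reach-lipschitz : ∀ {φ} → Lipschitz φ → ∀ {k x y} → Reach G k x y → φ y ≤ℕ k ℕ.+ φ x
  reach-lipschitz {φ} lip {zero} r = ℕₚ.≤-reflexive (cong φ (sym (reach-zero⁻ r)))
  reach-lipschitz lip {suc k} r with reach-suc⁻ r
  ... | inj₁ r′           = ℕₚ.m≤n⇒m≤1+n (reach-lipschitz lip r′)
  ... | inj₂ (_ , r′ , e) = ℕₚ.≤-trans (lip e) (s≤s (reach-lipschitz lip r′))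

  lipschitz-shift : ∀ {φ} c → Lipschitz φ → Lipschitz (λ a → c ℕ.+ φ a)
  lipschitz-shift c lip e = ℕₚ.≤-trans (ℕₚ.+-monoʳ-≤ c (lip e)) (ℕₚ.≤-reflexive (ℕₚ.+-suc c _))


module _ {m n} (G : Graph n) (H : Graph m) where

  reach-map : (f : Fin n → Fin m) → (∀ {a b} → Adj G a b → Adj H (f a) (f b)) →
              ∀ {k x y} → Reach G k x y → Reach H k (f x) (f y)
  reach-map f hom {zero} r rewrite reach-zero⁻ G r = reach-zero⁺ H
  reach-map f hom {suc k} r with reach-suc⁻ G r
  ... | inj₁ r′           = reach-weaken H (reach-map f hom r′)
  ... | inj₂ (_ , r′ , e) = reach-step H (reach-map f hom r′) (hom e)

ball : ∀ {n} → Graph n → ℕ → Fin n → Subset n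
ball G k x = tabulate (reach G k x)

∈-tabulate⁻ : ∀ {n} {f : Fin n → Bool} {y} → y ∈ tabulate f → T (f y)
∈-tabulate⁻ {f = f} {y} y∈ = from T-≡ (trans (sym (lookup∘tabulate f y)) ([]=⇒lookup y∈))

∈-tabulate⁺ : ∀ {n} {f : Fin n → Bool} {y} → T (f y) → y ∈ tabulate f
∈-tabulate⁺ {f = f} {y} t = lookup⇒[]= y (tabulate f) (trans (lookup∘tabulate f y) (to T-≡ t))

firstTrue-hit : ∀ f (p : ℕ → Bool) → T (p f) → T (p (firstTrue f p))
firstTrue-hit zero    p t = t
firstTrue-hit (suc f) p t with p zero in p0
... | true  = subst T (sym p0) _
... | false = firstTrue-hit f (p ∘ suc) t

firstTrue-minimal : ∀ f (p : ℕ → Bool) {k} → k ℕ.< firstTrue f p → ¬ T (p k)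
firstTrue-minimal (suc f) p k< with p zero in p0
firstTrue-minimal (suc f) p {zero}  _        | false = subst T p0
firstTrue-minimal (suc f) p {suc k} (s≤s k<) | false = firstTrue-minimal f (p ∘ suc) k<

module _ {n} (G : Graph n) where

  ∈ball⁻ : ∀ k x {y} → y ∈ ball G k x → Reach G k x y
  ∈ball⁻ k x y∈ = walk (∈-tabulate⁻ y∈)

  ∈ball⁺ : ∀ {k x y} → Reach G k x y → y ∈ ball G k x
  ∈ball⁺ (walk r) = ∈-tabulate⁺ r

  ball-⊆-suc : ∀ k x → ball G k x ⊆ ball G (suc k) x
  ball-⊆-suc k x y∈ = ∈ball⁺ (reach-weaken G (∈ball⁻ k x y∈))

  stable-ball : ∀ {j x} → ball G (suc j) x ⊆ ball G j x → ∀ d {y} → Reach G (d ℕ.+ j) x y → Reach G j x y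
  stable-ball         st zero    r = r
  stable-ball {j} {x} st (suc d) r with reach-suc⁻ G r
  ... | inj₁ r′           = stable-ball st d r′
  ... | inj₂ (_ , r′ , e) = ∈ball⁻ j x (st (∈ball⁺ (reach-step G (stable-ball st d r′) e)))

  ball-grows : ∀ x k → suc k ≤ℕ ∣ ball G k x ∣ ⊎ ∃ λ j → j ≤ℕ k × ball G (suc j) x ⊆ ball G j x
  ball-grows x zero =
    inj₁ (subst (ℕ._< ∣ ball G 0 x ∣) (∣⊥∣≡0 n) (p⊂q⇒∣p∣<∣q∣ (⊥⊆ , x , ∈ball⁺ (reach-zero⁺ G {x}) , ∉⊥)))
  ball-grows x (suc k) with ball-grows x k
  ... | inj₂ (j , j≤k , st) = inj₂ (j , ℕₚ.m≤n⇒m≤1+n j≤k , st)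
  ... | inj₁ big with ball G k x ⊂? ball G (suc k) x
  ...   | yes grows = inj₁ (ℕₚ.≤-trans (s≤s big) (p⊂q⇒∣p∣<∣q∣ grows))
  ...   | no ¬grows = inj₂ (k , ℕₚ.n≤1+n k , shrinks)
    where
    shrinks : ball G (suc k) x ⊆ ball G k x
    shrinks {y} y∈ with y ∈? ball G k x
    ... | yes y∈′ = y∈′
    ... | no  y∉  = contradiction ((λ {z} → ball-⊆-suc k x {z}) , y , y∈ , y∉) ¬grows

  -- Balls around x grow strictly until they stabilise, so within n steps; this is why the
  -- fuel n in dist suffices.
  reach-within : ∀ {m x y} → Reach G m x y → Reach G n x y
  reach-within {m} {x} {y} r with ball-grows x n
  ... | inj₁ big = contradiction (ℕₚ.≤-trans big (∣p∣≤n (ball G n x))) (ℕₚ.n≮n n)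
  ... | inj₂ (j , j≤n , st) with ℕₚ.≤-total m j
  ...   | inj₁ m≤j = reach-mono G (ℕₚ.≤-trans m≤j j≤n) r
  ...   | inj₂ j≤m = reach-mono G j≤n
                       (stable-ball st (m ℕ.∸ j) (subst (λ l → Reach G l x y) (sym (ℕₚ.m∸n+n≡m j≤m)) r))

  dist-reach : ∀ {k x y} → Reach G k x y → Reach G (dist G x y) x y
  dist-reach {x = x} {y} r = walk (firstTrue-hit n (λ k → reach G k x y) (Reach.reaches (reach-within r)))

  dist-minimal : ∀ {k x y} → Reach G k x y → dist G x y ≤ℕ k
  dist-minimal {x = x} {y} (walk r) = ℕₚ.≮⇒≥ (λ k<d → firstTrue-minimal n (λ k → reach G k x y) k<d r)

  dist-self : ∀ x → dist G x x ≡ 0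
  dist-self x = ℕₚ.n≤0⇒n≡0 (dist-minimal (reach-zero⁺ G))

  dist-from-lipschitz : ∀ {φ s t d} → Lipschitz G φ → φ s ≡ 0 → φ t ≡ d → Reach G d s t → dist G s t ≡ d
  dist-from-lipschitz {φ} {s} {t} lip φs≡0 φt≡d r = ℕₚ.≤-antisym (dist-minimal r)
    (subst (_≤ℕ dist G s t) φt≡d
      (ℕₚ.≤-trans (reach-lipschitz G lip (dist-reach r))
                  (ℕₚ.≤-reflexive (trans (cong (dist G s t ℕ.+_) φs≡0) (ℕₚ.+-identityʳ _)))))

module _ {n} {G : Graph n} (conn : Connected G) where

  reach-dist : ∀ x y → Reach G (dist G x y) x y
  reach-dist x y = dist-reach G {proj₁ (conn x y)} (walk (from T-≡ (proj₂ (conn x y))))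

  dist-lipschitz : ∀ s → Lipschitz G (dist G s)
  dist-lipschitz s {a} e = dist-minimal G (reach-step G (reach-dist s a) e)

m+1+n≤1+m : ∀ m {n} → n ≡ 0 → m ℕ.+ 1 ℕ.+ n ≤ℕ suc m
m+1+n≤1+m m refl = ℕₚ.≤-reflexive (trans (ℕₚ.+-identityʳ (m ℕ.+ 1)) (ℕₚ.+-comm m 1))

m≤1+[m+1+n] : ∀ m n → m ≤ℕ suc (m ℕ.+ 1 ℕ.+ n)
m≤1+[m+1+n] m n = ℕₚ.m≤n⇒m≤1+n (ℕₚ.≤-trans (ℕₚ.m≤m+n m 1) (ℕₚ.m≤m+n (m ℕ.+ 1) n))

module Bridge {n₁ n₂} (G₁ : Graph n₁) (G₂ : Graph n₂) (u : Fin n₁) (v : Fin n₂) where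

  B : Graph (n₁ ℕ.+ n₂)
  B = bridge G₁ G₂ u v

  adj-↑ˡ : ∀ x z → adj B (x ↑ˡ n₂) (z ↑ˡ n₂) ≡ adj G₁ x z
  adj-↑ˡ x z rewrite splitAt-↑ˡ n₁ x n₂ | splitAt-↑ˡ n₁ z n₂ = refl

  adj-↑ʳ : ∀ y w → adj B (n₁ ↑ʳ y) (n₁ ↑ʳ w) ≡ adj G₂ y w
  adj-↑ʳ y w rewrite splitAt-↑ʳ n₁ n₂ y | splitAt-↑ʳ n₁ n₂ w = refl

  adj-bridge : Adj B (u ↑ˡ n₂) (n₁ ↑ʳ v)
  adj-bridge = edge bridged
    where
    bridged : T (adj B (u ↑ˡ n₂) (n₁ ↑ʳ v))
    bridged rewrite splitAt-↑ˡ n₁ u n₂ | splitAt-↑ʳ n₁ n₂ v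
                  | dec-true (u ≟ᶠ u) refl | dec-true (v ≟ᶠ v) refl = _

  adj-bridge′ : Adj B (n₁ ↑ʳ v) (u ↑ˡ n₂)
  adj-bridge′ = edge (subst T (adj-sym B (u ↑ˡ n₂) (n₁ ↑ʳ v)) (Adj.adjacent adj-bridge))

  reach-↑ˡ : ∀ {k x z} → Reach G₁ k x z → Reach B k (x ↑ˡ n₂) (z ↑ˡ n₂)
  reach-↑ˡ = reach-map G₁ B (_↑ˡ n₂) λ {x} {z} (edge e) → edge (subst T (sym (adj-↑ˡ x z)) e)

  reach-↑ʳ : ∀ {k y w} → Reach G₂ k y w → Reach B k (n₁ ↑ʳ y) (n₁ ↑ʳ w)
  reach-↑ʳ = reach-map G₂ B (n₁ ↑ʳ_) λ {y} {w} (edge e) → edge (subst T (sym (adj-↑ʳ y w)) e)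

  bridge-lipschitz : ∀ {φ₁ φ₂} → Lipschitz G₁ φ₁ → Lipschitz G₂ φ₂ →
                     φ₂ v ≤ℕ suc (φ₁ u) → φ₁ u ≤ℕ suc (φ₂ v) → Lipschitz B (φ₁ ++ φ₂)
  bridge-lipschitz {φ₁} {φ₂} lip₁ lip₂ uv vu {a} {b} (edge e) with splitAt n₁ a | splitAt n₁ b
  ... | inj₁ x | inj₁ z = lip₁ (edge e)
  ... | inj₂ y | inj₂ w = lip₂ (edge e)
  ... | inj₁ x | inj₂ w with to T-∧ e
  ...   | x≟u , w≟v rewrite T-does⇒ (x ≟ᶠ u) x≟u | T-does⇒ (w ≟ᶠ v) w≟v = uv
  bridge-lipschitz {φ₁} {φ₂} lip₁ lip₂ uv vu {a} {b} (edge e)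
      | inj₂ y | inj₁ z with to T-∧ e
  ...   | z≟u , y≟v rewrite T-does⇒ (z ≟ᶠ u) z≟u | T-does⇒ (y ≟ᶠ v) y≟v = vu

  module _ (conn₁ : Connected G₁) (conn₂ : Connected G₂) where

    from-↑ˡ : Fin n₁ → Fin (n₁ ℕ.+ n₂) → ℕ
    from-↑ˡ x = dist G₁ x ++ λ w → dist G₁ x u ℕ.+ 1 ℕ.+ dist G₂ v w

    from-↑ʳ : Fin n₂ → Fin (n₁ ℕ.+ n₂) → ℕ
    from-↑ʳ y = (λ z → dist G₂ y v ℕ.+ 1 ℕ.+ dist G₁ u z) ++ dist G₂ y

    lipschitz-↑ˡ : ∀ x → Lipschitz B (from-↑ˡ x)
    lipschitz-↑ˡ x = bridge-lipschitz (dist-lipschitz conn₁ x)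
      (lipschitz-shift G₂ (dist G₁ x u ℕ.+ 1) (dist-lipschitz conn₂ v))
      (m+1+n≤1+m (dist G₁ x u) (dist-self G₂ v)) (m≤1+[m+1+n] (dist G₁ x u) (dist G₂ v v))

    lipschitz-↑ʳ : ∀ y → Lipschitz B (from-↑ʳ y)
    lipschitz-↑ʳ y = bridge-lipschitz
      (lipschitz-shift G₁ (dist G₂ y v ℕ.+ 1) (dist-lipschitz conn₁ u)) (dist-lipschitz conn₂ y)
      (m≤1+[m+1+n] (dist G₂ y v) (dist G₁ u u)) (m+1+n≤1+m (dist G₂ y v) (dist-self G₁ u))

    dist-↑ˡ-↑ˡ : ∀ x z → dist B (x ↑ˡ n₂) (z ↑ˡ n₂) ≡ dist G₁ x z
    dist-↑ˡ-↑ˡ x z = dist-from-lipschitz B (lipschitz-↑ˡ x)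
      (trans (lookup-++ˡ (dist G₁ x) _ x) (dist-self G₁ x)) (lookup-++ˡ (dist G₁ x) _ z)
      (reach-↑ˡ (reach-dist conn₁ x z))

    dist-↑ˡ-↑ʳ : ∀ x w → dist B (x ↑ˡ n₂) (n₁ ↑ʳ w) ≡ dist G₁ x u ℕ.+ 1 ℕ.+ dist G₂ v w
    dist-↑ˡ-↑ʳ x w = dist-from-lipschitz B (lipschitz-↑ˡ x)
      (trans (lookup-++ˡ (dist G₁ x) _ x) (dist-self G₁ x)) (lookup-++ʳ (dist G₁ x) _ w)
      (reach-trans B (reach-trans B (reach-↑ˡ (reach-dist conn₁ x u)) (reach-edge B adj-bridge))
                     (reach-↑ʳ (reach-dist conn₂ v w)))

    dist-↑ʳ-↑ˡ : ∀ y z → dist B (n₁ ↑ʳ y) (z ↑ˡ n₂) ≡ dist G₂ y v ℕ.+ 1 ℕ.+ dist G₁ u z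
    dist-↑ʳ-↑ˡ y z = dist-from-lipschitz B (lipschitz-↑ʳ y)
      (trans (lookup-++ʳ (λ z → dist G₂ y v ℕ.+ 1 ℕ.+ dist G₁ u z) (dist G₂ y) y) (dist-self G₂ y)) (lookup-++ˡ (λ z → dist G₂ y v ℕ.+ 1 ℕ.+ dist G₁ u z) (dist G₂ y) z)
      (reach-trans B (reach-trans B (reach-↑ʳ (reach-dist conn₂ y v)) (reach-edge B adj-bridge′))
                     (reach-↑ˡ (reach-dist conn₁ u z)))

    dist-↑ʳ-↑ʳ : ∀ y w → dist B (n₁ ↑ʳ y) (n₁ ↑ʳ w) ≡ dist G₂ y w
    dist-↑ʳ-↑ʳ y w = dist-from-lipschitz B (lipschitz-↑ʳ y)
      (trans (lookup-++ʳ (λ z → dist G₂ y v ℕ.+ 1 ℕ.+ dist G₁ u z) (dist G₂ y) y) (dist-self G₂ y)) (lookup-++ʳ (λ z → dist G₂ y v ℕ.+ 1 ℕ.+ dist G₁ u z) (dist G₂ y) w)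
      (reach-↑ʳ (reach-dist conn₂ y w))

    distMatrix-isBridgeMatrix : IsBridgeMatrix (distMatrix G₁) (distMatrix G₂) u v (distMatrix B)
    distMatrix-isBridgeMatrix = record
      { ↑ˡ-↑ˡ = λ x z → cong ℕtoℚ (dist-↑ˡ-↑ˡ x z)
      ; ↑ˡ-↑ʳ = λ x w → trans (cong ℕtoℚ (dist-↑ˡ-↑ʳ x w)) (ℕtoℚ-+1+ (dist G₁ x u) (dist G₂ v w))
      ; ↑ʳ-↑ˡ = λ y z → trans (cong ℕtoℚ (dist-↑ʳ-↑ˡ y z)) (ℕtoℚ-+1+ (dist G₂ y v) (dist G₁ u z))
      ; ↑ʳ-↑ʳ = λ y w → cong ℕtoℚ (dist-↑ʳ-↑ʳ y w)
      }

theorem3p5 : (n₁ n₂ : ℕ) → 2 ≤ℕ n₁ → 2 ≤ℕ n₂ →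
    (G₁ : Graph n₁) (G₂ : Graph n₂) → Connected G₁ → Connected G₂ →
    (u : Fin n₁) (v : Fin n₂) →
    (K₁ : Fin n₁ → ℚ) (K₂ : Fin n₂ → ℚ) (KG : Fin (n₁ Data.Nat.+ n₂) → ℚ) →
    SteinerbergerCurvature G₁ K₁ → SteinerbergerCurvature G₂ K₂ →
    SteinerbergerCurvature (bridge G₁ G₂ u v) KG →
    let k₁ = sumF K₁
        k₂ = sumF K₂
        Z  = (ℕtoℚ 2 + k₁ ÷ ℕtoℚ n₁) * (ℕtoℚ 2 + k₂ ÷ ℕtoℚ n₂)
        ku = K₁ u
        kv = K₂ v
        α  = (ℕtoℚ 2 * ℕtoℚ (n₁ Data.Nat.+ n₂) * k₂) ÷ (ℕtoℚ n₁ * ℕtoℚ n₂ * (Z - ℕtoℚ 4))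
        β  = (ℕtoℚ 2 * ℕtoℚ (n₁ Data.Nat.+ n₂) * k₁) ÷ (ℕtoℚ n₁ * ℕtoℚ n₂ * (Z - ℕtoℚ 4))
        γ  = (ℕtoℚ 1 - k₁ ÷ (ℕtoℚ 2 * ku)) * α
        δ  = (ℕtoℚ 1 - k₂ ÷ (ℕtoℚ 2 * kv)) * β
    in Z ≢ ℕtoℚ 4 →
       Invertible (distMatrix G₁) → Invertible (distMatrix G₂) →
       ku ≢ 0ℚ → kv ≢ 0ℚ →
       (∀ (x : Fin n₁) → x ≢ u → KG (x ↑ˡ n₂) ≡ α * K₁ x)
       × (∀ (y : Fin n₂) → y ≢ v → KG (n₁ ↑ʳ y) ≡ β * K₂ y)
       × KG (u ↑ˡ n₂) ≡ γ * ku
       × KG (n₁ ↑ʳ v) ≡ δ * kv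
theorem3p5 n₁ n₂ 2≤n₁ 2≤n₂ G₁ G₂ conn₁ conn₂ u v K₁ K₂ KG curv₁ curv₂ curvG Z≢4 inv₁ inv₂ ku≢0 kv≢0 =
    (λ x x≢u → trans (on-V₁ x) (lincomb-offdiag α K₁ (α * sumF K₁ * ½) (x≢u ∘ sym)))
  , (λ y y≢v → trans (on-V₂ y) (lincomb-offdiag β K₂ (β * sumF K₂ * ½) (y≢v ∘ sym)))
  , trans (on-V₁ u) (lincomb-diag-½ α K₁ u ku≢0)
  , trans (on-V₂ v) (lincomb-diag-½ β K₂ v kv≢0)
  where
  open Scaling (ℕtoℚ (n₁ ℕ.+ n₂)) (ℕtoℚ n₁) (ℕtoℚ n₂) (sumF K₁) (sumF K₂) using (α; β)
  open BridgeSystem (Bridge.distMatrix-isBridgeMatrix G₁ G₂ u v conn₁ conn₂)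
    (curvature-solves (invertible⇒solvable inv₁) curv₁) (curvature-solves (invertible⇒solvable inv₂) curv₂)
    (cong ℕtoℚ (dist-self G₁ u)) (cong ℕtoℚ (dist-self G₂ v))
  blocks : take n₁ KG ≗ lincomb α K₁ (α * sumF K₁ * ½) u × drop n₁ KG ≗ lincomb β K₂ (β * sumF K₂ * ½) v
  blocks = bridge-curvature inv₁ inv₂ (ℕtoℚ-≢0 (ℕₚ.<⇒≤ 2≤n₁)) (ℕtoℚ-≢0 (ℕₚ.<⇒≤ 2≤n₂)) Z≢4 curvG
  on-V₁ : take n₁ KG ≗ lincomb α K₁ (α * sumF K₁ * ½) u
  on-V₁ = proj₁ blocks
  on-V₂ : drop n₁ KG ≗ lincomb β K₂ (β * sumF K₂ * ½) v
  on-V₂ = proj₂ blocks
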